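{- For positive integers $n$ and $q$, $M(\overline{2},n,q)\le q^{\lceil 2n/3\rceil}+\frac{1}{2}q^{\lfloor n/3\rfloor}\left(q^{\lfloor n/3\rfloor}-1\right)$.
   Context: An $(n,M,q)$ code is a set $\mathcal{C}\subseteq Q^n$ of $M$ distinct codewords, $|Q|=q$. For $\mathcal{C}_0\subseteq\mathcal{C}$, let $\mathcal{C}_0(i)=\{\mathbf{c}(i):\mathbf{c}\in\mathcal{C}_0\}$ and $\mathsf{desc}(\mathcal{C}_0)=\mathcal{C}_0(1)\times\cdots\times\mathcal{C}_0(n)$. $\mathcal{C}$ is a strongly $\overline{t}$-separable code ($\overline{t}$-SSC$(n,M,q)$) if for every $\mathcal{C}_0\subseteq\mathcal{C}$ with $1\le|\mathcal{C}_0|\le t$, $\bigcap_{\mathcal{C}'\in S(\mathcal{C}_0)}\mathcal{C}'=\mathcal{C}_0$, where $S(\mathcal{C}_0)=\{\mathcal{C}'\subseteq\mathcal{C}:\mathsf{desc}(\mathcal{C}')=\mathsf{desc}(\mathcal{C}_0)\}$. $M(\overline{t},n,q)$ denotes the maximum $M$ such that a $\overline{t}$-SSC$(n,M,q)$ exists. -}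

module Defs where

open import Data.Nat using (ℕ; _+_; _*_; _∸_; _^_; _≤_; _/_)
open import Data.Fin using (Fin)
open import Data.Fin.Subset using (Subset; _∈_; ∣_∣)
open import Data.Product using (_×_; Σ)
open import Function.Definitions using (Injective)
open import Relation.Binary.PropositionalEquality using (_≡_)

Word : ℕ → ℕ → Set
Word n q = Fin n → Fin q

record Code (n M q : ℕ) : Set where
  field
    cw       : Fin M → Word n q
    distinct : Injective _≡_ _≡_ cw
open Code public

-- Sub-codes C₀ ⊆ C are subsets of the index set Fin M.
-- Membership of symbol a in the i-th projection C₀(i).
InProj : ∀ {n M q} → Code n M q → Subset M → Fin n → Fin q → Set
InProj C C₀ i a = Σ (Fin _) λ j → (j ∈ C₀) × (cw C j i ≡ a)

InDesc : ∀ {n M q} → Code n M q → Subset M → Word n q → Set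
InDesc C C₀ w = ∀ i → InProj C C₀ i (w i)

SameDesc : ∀ {n M q} → Code n M q → Subset M → Subset M → Set
SameDesc {n} {M} {q} C C′ C₀ =
  ∀ (w : Word n q) → (InDesc C C′ w → InDesc C C₀ w) × (InDesc C C₀ w → InDesc C C′ w)

IntersectionProperty : ∀ {n M q} → Code n M q → Subset M → Set
IntersectionProperty {n} {M} {q} C C₀ =
  ∀ (j : Fin M) →
    ((∀ (C′ : Subset M) → SameDesc C C′ C₀ → j ∈ C′) → j ∈ C₀)
    × (j ∈ C₀ → ∀ (C′ : Subset M) → SameDesc C C′ C₀ → j ∈ C′)

IsSSC : ∀ {n M q} → ℕ → Code n M q → Set
IsSSC {n} {M} {q} t C =
  ∀ (C₀ : Subset M) → 1 ≤ ∣ C₀ ∣ → ∣ C₀ ∣ ≤ t → IntersectionProperty C C₀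

ceil2n/3 : ℕ → ℕ
ceil2n/3 n = (2 * n + 2) / 3

floorn/3 : ℕ → ℕ
floorn/3 n = n / 3

-- q^{⌈2n/3⌉} + ½ q^{⌊n/3⌋}(q^{⌊n/3⌋} − 1)  (the product is even, so / 2 is exact)
bound : ℕ → ℕ → ℕ
bound n q = q ^ ceil2n/3 n + (q ^ floorn/3 n * (q ^ floorn/3 n ∸ 1)) / 2

module Submission where

-- Split the coordinates
-- into a left block of length x = ⌊n/3⌋ and a right block of length
-- m = ⌈2n/3⌉; a codeword is a pair (ℓ, r) of halves, ℓ among N = q^x and r
-- among K = q^m values.  In a 2̄-SSC
--   * a codeword is determined by its two halves (separation of singletons);
--   * no "rectangle" (ℓ₁,r₁), (ℓ₂,r₂), (ℓ₂,r₁), (ℓ₁,r₂) with ℓ₁ ≠ ℓ₂, r₁ ≠ r₂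
--     lies in the code, since {(ℓ₂,r₁),(ℓ₁,r₂),(ℓ₂,r₂)} has the same
--     descendant set as {(ℓ₁,r₁),(ℓ₂,r₂)}.
-- Choose one representative in every class of codewords with equal right
-- half.  Representatives are coded by their right half (< K values), every
-- other codeword c by the unordered pair {ℓ(rep c), ℓ(c)} of distinct left
-- halves (< N(N−1)/2 values).  The two facts above make this coding
-- injective, so M ≤ K + N(N−1)/2, and ⌊n/3⌋ + ⌈2n/3⌉ = n gives the theorem.

open import Defs
open import Data.Nat using (ℕ; zero; suc; _+_; _*_; _∸_; _^_; _/_; _≤_; _<_; _⊔_; _⊓_; z≤n; s≤s)
open import Data.Nat.Properties
open import Data.Nat.DivMod using (m*n/n≡m; +-distrib-/-∣ˡ)
open import Data.Nat.Divisibility using (divides)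
open import Data.Fin using (Fin; toℕ; fromℕ<; _↑ˡ_; _↑ʳ_; splitAt; funToFin; finToFun) renaming (_≟_ to _≟ᶠ_)
open import Data.Fin.Properties using (toℕ-injective; toℕ<n; toℕ-fromℕ<; join-splitAt; any?; finToFun-funToFin; injective⇒≤)
open import Data.Fin.Subset using (Subset; _∈_; _⊆_; ∣_∣; ⁅_⁆; _∪_; inside; outside)
open import Data.Fin.Subset.Properties using (x∈⁅x⁆; x∈⁅y⁆⇒x≡y; x∈p∪q⁻; x∈p∪q⁺; ∣⁅x⁆∣≡1; ∣p∣≤∣p∪q∣)
open import Data.Vec using ([]; _∷_)
open import Data.Product using (_×_; _,_; proj₁; proj₂; ∃)
open import Data.Sum using (_⊎_; inj₁; inj₂)
open import Data.Empty using (⊥; ⊥-elim)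
open import Relation.Nullary using (yes; no)
open import Relation.Binary.Definitions using (DecidableEquality; tri<; tri≈; tri>)
open import Relation.Binary.PropositionalEquality using (_≡_; _≢_; refl; sym; trans; cong; cong₂; subst; module ≡-Reasoning)

-- The triangular number triangle v = 0 + 1 + ⋯ + (v − 1) = C(v, 2), the
-- number of unordered pairs of distinct elements of a v-element set.
triangle : ℕ → ℕ
triangle zero    = zero
triangle (suc v) = triangle v + v

-- Twice a triangular number, avoiding division.
triangle-double : ∀ v → triangle v * 2 ≡ v * (v ∸ 1)
triangle-double zero          = refl
triangle-double (suc zero)    = refl
triangle-double (suc (suc w)) = begin
  (triangle (suc w) + suc w) * 2   ≡⟨ *-distribʳ-+ 2 (triangle (suc w)) (suc w) ⟩
  triangle (suc w) * 2 + suc w * 2 ≡⟨ cong (_+ suc w * 2) (triangle-double (suc w)) ⟩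
  suc w * w + suc w * 2            ≡⟨ *-distribˡ-+ (suc w) w 2 ⟨
  suc w * (w + 2)                  ≡⟨ cong (suc w *_) (+-comm w 2) ⟩
  suc w * suc (suc w)              ≡⟨ *-comm (suc w) (suc (suc w)) ⟩
  suc (suc w) * suc w              ∎
  where open ≡-Reasoning

triangle-closed-form : ∀ v → triangle v ≡ v * (v ∸ 1) / 2
triangle-closed-form v = trans (sym (m*n/n≡m (triangle v) 2)) (cong (_/ 2) (triangle-double v))

triangle-mono-≤ : ∀ {a b} → a ≤ b → triangle a ≤ triangle b
triangle-mono-≤ z≤n       = z≤n
triangle-mono-≤ (s≤s a≤b) = +-mono-≤ (triangle-mono-≤ a≤b) a≤b

triangle-row-< : ∀ {a b N} → b < a → a < N → triangle a + b < triangle N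
triangle-row-< {a} b<a a<N = <-≤-trans (+-monoʳ-< (triangle a) b<a) (triangle-mono-≤ a<N)

-- Distinct rows are disjoint, so (a, b) ↦ triangle a + b (b < a) is injective.
triangle-row-injective : ∀ {a b a′ b′} → b < a → b′ < a′ →
                         triangle a + b ≡ triangle a′ + b′ → a ≡ a′ × b ≡ b′
triangle-row-injective {a} {b} {a′} {b′} b<a b′<a′ eq with <-cmp a a′
... | tri< a<a′ _ _ = ⊥-elim (<⇒≢ (≤-trans (triangle-row-< b<a a<a′) (m≤m+n _ b′)) eq)
... | tri> _ _ a′<a = ⊥-elim (<⇒≢ (≤-trans (triangle-row-< b′<a′ a′<a) (m≤m+n _ b)) (sym eq))
... | tri≈ _ refl _ = refl , +-cancelˡ-≡ (triangle a) b b′ eq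

max-min-determine : ∀ {u v u′ v′} → u ⊔ v ≡ u′ ⊔ v′ → u ⊓ v ≡ u′ ⊓ v′ →
                    (u ≡ u′ × v ≡ v′) ⊎ (u ≡ v′ × v ≡ u′)
max-min-determine {u} {v} {u′} {v′} max≡ min≡ with ≤-total u v | ≤-total u′ v′
... | inj₁ u≤v | inj₁ u′≤v′
  rewrite m≤n⇒m⊔n≡n u≤v | m≤n⇒m⊓n≡m u≤v | m≤n⇒m⊔n≡n u′≤v′ | m≤n⇒m⊓n≡m u′≤v′ = inj₁ (min≡ , max≡)
... | inj₁ u≤v | inj₂ v′≤u′
  rewrite m≤n⇒m⊔n≡n u≤v | m≤n⇒m⊓n≡m u≤v | m≥n⇒m⊔n≡m v′≤u′ | m≥n⇒m⊓n≡n v′≤u′ = inj₂ (min≡ , max≡)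
... | inj₂ v≤u | inj₁ u′≤v′
  rewrite m≥n⇒m⊔n≡m v≤u | m≥n⇒m⊓n≡n v≤u | m≤n⇒m⊔n≡n u′≤v′ | m≤n⇒m⊓n≡m u′≤v′ = inj₂ (max≡ , min≡)
... | inj₂ v≤u | inj₂ v′≤u′
  rewrite m≥n⇒m⊔n≡m v≤u | m≥n⇒m⊓n≡n v≤u | m≥n⇒m⊔n≡m v′≤u′ | m≥n⇒m⊓n≡n v′≤u′ = inj₁ (max≡ , min≡)

min<max : ∀ {u v} → u ≢ v → u ⊓ v < u ⊔ v
min<max {u} {v} u≢v with ≤-total u v
... | inj₁ u≤v rewrite m≤n⇒m⊔n≡n u≤v | m≤n⇒m⊓n≡m u≤v = ≤∧≢⇒< u≤v u≢v
... | inj₂ v≤u rewrite m≥n⇒m⊔n≡m v≤u | m≥n⇒m⊓n≡n v≤u = ≤∧≢⇒< v≤u (λ v≡u → u≢v (sym v≡u))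

-- Code of the unordered pair {u, v}: a bijection from 2-subsets of {0,…,N−1}
-- onto {0,…,triangle N − 1}.
pair : ℕ → ℕ → ℕ
pair u v = triangle (u ⊔ v) + u ⊓ v

pair-< : ∀ {u v N} → u ≢ v → u < N → v < N → pair u v < triangle N
pair-< u≢v u<N v<N = triangle-row-< (min<max u≢v) (⊔-pres-<m u<N v<N)

pair-injective : ∀ {u v u′ v′} → u ≢ v → u′ ≢ v′ → pair u v ≡ pair u′ v′ →
                 (u ≡ u′ × v ≡ v′) ⊎ (u ≡ v′ × v ≡ u′)
pair-injective u≢v u′≢v′ eq =
  let max≡ , min≡ = triangle-row-injective (min<max u≢v) (min<max u′≢v′) eq
  in max-min-determine max≡ min≡

shift-/3 : ∀ k r → (k * 3 + r) / 3 ≡ k + r / 3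
shift-/3 k r = trans (+-distrib-/-∣ˡ r (divides k refl)) (cong (_+ r / 3) (m*n/n≡m k 3))

floor+ceil≡n : ∀ n → floorn/3 n + ceil2n/3 n ≡ n
floor+ceil≡n 0 = refl
floor+ceil≡n 1 = refl
floor+ceil≡n 2 = refl
floor+ceil≡n (suc (suc (suc n))) = begin
  (1 * 3 + n) / 3 + (2 * (3 + n) + 2) / 3   ≡⟨ cong₂ _+_ (shift-/3 1 n) (cong (_/ 3) double+2) ⟩
  suc (n / 3) + (2 * 3 + (2 * n + 2)) / 3   ≡⟨ cong (suc (n / 3) +_) (shift-/3 2 (2 * n + 2)) ⟩
  suc (n / 3) + suc (suc ((2 * n + 2) / 3)) ≡⟨ cong suc (trans (+-suc (n / 3) _) (cong suc (+-suc (n / 3) _))) ⟩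
  3 + (n / 3 + (2 * n + 2) / 3)             ≡⟨ cong (3 +_) (floor+ceil≡n n) ⟩
  3 + n                                     ∎
  where
  open ≡-Reasoning
  double+2 : 2 * (3 + n) + 2 ≡ 2 * 3 + (2 * n + 2)
  double+2 = trans (cong (_+ 2) (*-distribˡ-+ 2 3 n)) (+-assoc (2 * 3) (2 * n) 2)

∣p∪q∣≤∣p∣+∣q∣ : ∀ {n} (p q : Subset n) → ∣ p ∪ q ∣ ≤ ∣ p ∣ + ∣ q ∣
∣p∪q∣≤∣p∣+∣q∣ []            []            = z≤n
∣p∪q∣≤∣p∣+∣q∣ (outside ∷ p) (outside ∷ q) = ∣p∪q∣≤∣p∣+∣q∣ p q
∣p∪q∣≤∣p∣+∣q∣ (outside ∷ p) (inside ∷ q)  = ≤-trans (s≤s (∣p∪q∣≤∣p∣+∣q∣ p q)) (≤-reflexive (sym (+-suc ∣ p ∣ ∣ q ∣)))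
∣p∪q∣≤∣p∣+∣q∣ (inside ∷ p)  (outside ∷ q) = s≤s (∣p∪q∣≤∣p∣+∣q∣ p q)
∣p∪q∣≤∣p∣+∣q∣ (inside ∷ p)  (inside ∷ q)  = s≤s (≤-trans (∣p∪q∣≤∣p∣+∣q∣ p q) (+-monoʳ-≤ ∣ p ∣ (n≤1+n ∣ q ∣)))

doubleton : ∀ {M} → Fin M → Fin M → Subset M
doubleton a b = ⁅ a ⁆ ∪ ⁅ b ⁆

∣doubleton∣≥1 : ∀ {M} (a b : Fin M) → 1 ≤ ∣ doubleton a b ∣
∣doubleton∣≥1 a b = ≤-trans (≤-reflexive (sym (∣⁅x⁆∣≡1 a))) (∣p∣≤∣p∪q∣ ⁅ a ⁆ ⁅ b ⁆)

∣doubleton∣≤2 : ∀ {M} (a b : Fin M) → ∣ doubleton a b ∣ ≤ 2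
∣doubleton∣≤2 a b = ≤-trans (∣p∪q∣≤∣p∣+∣q∣ ⁅ a ⁆ ⁅ b ⁆) (≤-reflexive (cong₂ _+_ (∣⁅x⁆∣≡1 a) (∣⁅x⁆∣≡1 b)))

∈doubletonˡ : ∀ {M} (a b : Fin M) → a ∈ doubleton a b
∈doubletonˡ a b = x∈p∪q⁺ (inj₁ (x∈⁅x⁆ a))

∈doubletonʳ : ∀ {M} (a b : Fin M) → b ∈ doubleton a b
∈doubletonʳ a b = x∈p∪q⁺ (inj₂ (x∈⁅x⁆ b))

∈doubleton⁻ : ∀ {M} {j a b : Fin M} → j ∈ doubleton a b → j ≡ a ⊎ j ≡ b
∈doubleton⁻ {a = a} {b} j∈ with x∈p∪q⁻ ⁅ a ⁆ ⁅ b ⁆ j∈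
... | inj₁ j∈a = inj₁ (x∈⁅y⁆⇒x≡y a j∈a)
... | inj₂ j∈b = inj₂ (x∈⁅y⁆⇒x≡y b j∈b)

injective-below⇒≤ : ∀ {M B} (f : Fin M → ℕ) → (∀ c → f c < B) →
                    (∀ {c d} → f c ≡ f d → c ≡ d) → M ≤ B
injective-below⇒≤ f f<B f-injective = injective⇒≤ {f = λ c → fromℕ< (f<B c)} λ {c} {d} e →
  f-injective (trans (sym (toℕ-fromℕ< (f<B c))) (trans (cong toℕ e) (toℕ-fromℕ< (f<B d))))

funToFin-injective : ∀ {a b} {f g : Fin a → Fin b} → funToFin f ≡ funToFin g → ∀ k → f k ≡ g k
funToFin-injective {f = f} {g} e k =
  trans (sym (finToFun-funToFin f k)) (trans (cong (λ z → finToFun z k) e) (finToFun-funToFin g k))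

module _ {n M q : ℕ} (C : Code n M q) where

  sameProjections⇒SameDesc : ∀ {C′ C₀ : Subset M} →
    (∀ i s → InProj C C′ i s → InProj C C₀ i s) →
    (∀ i s → InProj C C₀ i s → InProj C C′ i s) → SameDesc C C′ C₀
  sameProjections⇒SameDesc to₀ to′ w = (λ d i → to₀ i (w i) (d i)) , (λ d i → to′ i (w i) (d i))

  ssc-member : ∀ {t} {C₀ C′ : Subset M} → IsSSC t C → 1 ≤ ∣ C₀ ∣ → ∣ C₀ ∣ ≤ t →
               SameDesc C C′ C₀ → C₀ ⊆ C′
  ssc-member {C′ = C′} ssc lo hi same {j} j∈C₀ = proj₂ (ssc _ lo hi j) j∈C₀ C′ same

  ssc-separates : ∀ {t} → 1 ≤ t → IsSSC t C → ∀ {c d} → (∀ i → cw C c i ≡ cw C d i) → c ≡ d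
  ssc-separates 1≤t ssc {c} {d} agree =
    x∈⁅y⁆⇒x≡y d (ssc-member ssc (≤-reflexive (sym (∣⁅x⁆∣≡1 c))) (≤-trans (≤-reflexive (∣⁅x⁆∣≡1 c)) 1≤t)
                            same (x∈⁅x⁆ c))
    where
    same : SameDesc C ⁅ d ⁆ ⁅ c ⁆
    same = sameProjections⇒SameDesc
      (λ i s → λ { (j , j∈d , refl) → c , x∈⁅x⁆ c , trans (agree i) (cong (λ k → cw C k i) (sym (x∈⁅y⁆⇒x≡y d j∈d))) })
      (λ i s → λ { (j , j∈c , refl) → d , x∈⁅x⁆ d , trans (sym (agree i)) (cong (λ k → cw C k i) (sym (x∈⁅y⁆⇒x≡y c j∈c))) })

  -- Applied to pairs: if at every coordinate the symbols of c₁, c₂ are those of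
  -- a, b (in either order), then {b, c₁, c₂} has the same descendants as
  -- {a, b}, so a must be one of b, c₁, c₂.
  ssc-crossing : IsSSC 2 C → ∀ {a b c₁ c₂} →
    (∀ i → (cw C c₁ i ≡ cw C a i × cw C c₂ i ≡ cw C b i) ⊎ (cw C c₁ i ≡ cw C b i × cw C c₂ i ≡ cw C a i)) →
    a ≡ b ⊎ a ≡ c₁ ⊎ a ≡ c₂
  ssc-crossing ssc {a} {b} {c₁} {c₂} crossed =
    members (ssc-member ssc (∣doubleton∣≥1 a b) (∣doubleton∣≤2 a b) same (∈doubletonˡ a b))
    where
    C′ : Subset M
    C′ = ⁅ b ⁆ ∪ doubleton c₁ c₂

    members : ∀ {j} → j ∈ C′ → j ≡ b ⊎ j ≡ c₁ ⊎ j ≡ c₂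
    members j∈ with x∈p∪q⁻ ⁅ b ⁆ (doubleton c₁ c₂) j∈
    ... | inj₁ j∈b  = inj₁ (x∈⁅y⁆⇒x≡y b j∈b)
    ... | inj₂ j∈cc = inj₂ (∈doubleton⁻ j∈cc)

    b∈C′ : b ∈ C′
    b∈C′ = x∈p∪q⁺ (inj₁ (x∈⁅x⁆ b))

    c₁∈C′ : c₁ ∈ C′
    c₁∈C′ = x∈p∪q⁺ {p = ⁅ b ⁆} (inj₂ (∈doubletonˡ c₁ c₂))

    c₂∈C′ : c₂ ∈ C′
    c₂∈C′ = x∈p∪q⁺ {p = ⁅ b ⁆} (inj₂ (∈doubletonʳ c₁ c₂))

    to₀ : ∀ i s → InProj C C′ i s → InProj C (doubleton a b) i s
    to₀ i s (j , j∈ , refl) with members j∈ | crossed i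
    ... | inj₁ refl        | _           = b , ∈doubletonʳ a b , refl
    ... | inj₂ (inj₁ refl) | inj₁ (e , _) = a , ∈doubletonˡ a b , sym e
    ... | inj₂ (inj₁ refl) | inj₂ (e , _) = b , ∈doubletonʳ a b , sym e
    ... | inj₂ (inj₂ refl) | inj₁ (_ , e) = b , ∈doubletonʳ a b , sym e
    ... | inj₂ (inj₂ refl) | inj₂ (_ , e) = a , ∈doubletonˡ a b , sym e

    to′ : ∀ i s → InProj C (doubleton a b) i s → InProj C C′ i s
    to′ i s (j , j∈ , refl) with ∈doubleton⁻ j∈ | crossed i
    ... | inj₂ refl | _           = b , b∈C′ , refl
    ... | inj₁ refl | inj₁ (e , _) = c₁ , c₁∈C′ , e
    ... | inj₁ refl | inj₂ (_ , e) = c₂ , c₂∈C′ , e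

    same : SameDesc C C′ (doubleton a b)
    same = sameProjections⇒SameDesc to₀ to′

module Representatives {M : ℕ} {B : Set} (_≟ᴮ_ : DecidableEquality B) (f : Fin M → B) where

  choose : (b : B) → ∃ (λ j → f j ≡ b) → ∃ (λ j → f j ≡ b)
  choose b nonempty with any? (λ j → f j ≟ᴮ b)
  ... | yes found = found
  ... | no none   = ⊥-elim (none nonempty)

  choose-irrelevant : ∀ {b b′} (e : ∃ λ j → f j ≡ b) (e′ : ∃ λ j → f j ≡ b′) →
                      b ≡ b′ → proj₁ (choose b e) ≡ proj₁ (choose b′ e′)
  choose-irrelevant {b} e e′ refl with any? (λ j → f j ≟ᴮ b)
  ... | yes _   = refl
  ... | no none = ⊥-elim (none e)

  rep : Fin M → Fin M
  rep c = proj₁ (choose (f c) (c , refl))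

  rep-fibre : ∀ c → f (rep c) ≡ f c
  rep-fibre c = proj₂ (choose (f c) (c , refl))

  rep-cong : ∀ {c d} → f c ≡ f d → rep c ≡ rep d
  rep-cong {c} {d} = choose-irrelevant (c , refl) (d , refl)

module SplitCode {x m q M : ℕ} (C : Code (x + m) M q) (ssc : IsSSC 2 C) where

  N K : ℕ
  N = q ^ x
  K = q ^ m

  left : Fin M → Fin N
  left c = funToFin (λ k → cw C c (k ↑ˡ m))

  right : Fin M → Fin K
  right c = funToFin (λ k → cw C c (x ↑ʳ k))

  leftℕ : Fin M → ℕ
  leftℕ c = toℕ (left c)

  block : ∀ i → ∃ (λ k → k ↑ˡ m ≡ i) ⊎ ∃ (λ k → x ↑ʳ k ≡ i)
  block i with splitAt x i | join-splitAt x m i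
  ... | inj₁ k | k≡i = inj₁ (k , k≡i)
  ... | inj₂ k | k≡i = inj₂ (k , k≡i)

  halves-determine : ∀ {a b} → left a ≡ left b → right a ≡ right b → a ≡ b
  halves-determine {a} {b} ℓ≡ r≡ = ssc-separates C (s≤s z≤n) ssc agree
    where
    agree : ∀ i → cw C a i ≡ cw C b i
    agree i with block i
    ... | inj₁ (k , refl) = funToFin-injective ℓ≡ k
    ... | inj₂ (k , refl) = funToFin-injective r≡ k

  rectangle-free : ∀ {a b c₁ c₂} → left a ≢ left b → right a ≢ right b →
                   left c₁ ≡ left b → right c₁ ≡ right a →
                   left c₂ ≡ left a → right c₂ ≡ right b → ⊥
  rectangle-free {a} {b} {c₁} {c₂} ℓa≢ℓb ra≢rb ℓ₁ r₁ ℓ₂ r₂ with ssc-crossing C ssc crossed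
    where
    crossed : ∀ i → (cw C c₁ i ≡ cw C a i × cw C c₂ i ≡ cw C b i) ⊎ (cw C c₁ i ≡ cw C b i × cw C c₂ i ≡ cw C a i)
    crossed i with block i
    ... | inj₁ (k , refl) = inj₂ (funToFin-injective ℓ₁ k , funToFin-injective ℓ₂ k)
    ... | inj₂ (k , refl) = inj₁ (funToFin-injective r₁ k , funToFin-injective r₂ k)
  ... | inj₁ a≡b         = ℓa≢ℓb (cong left a≡b)
  ... | inj₂ (inj₁ a≡c₁) = ℓa≢ℓb (trans (cong left a≡c₁) ℓ₁)
  ... | inj₂ (inj₂ a≡c₂) = ra≢rb (trans (cong right a≡c₂) r₂)

  open Representatives _≟ᶠ_ right

  rep-left≢ : ∀ {c} → c ≢ rep c → leftℕ (rep c) ≢ leftℕ c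
  rep-left≢ {c} c≢rep eq = c≢rep (sym (halves-determine (toℕ-injective eq) (rep-fibre c)))

  -- Non-representatives are determined by the unordered pair of left halves
  -- {left (rep c), left c}: equal pairs either force equal halves or produce
  -- a forbidden rectangle.
  nonrep-injective : ∀ {c d} (c≢rep : c ≢ rep c) (d≢rep : d ≢ rep d) →
    pair (leftℕ (rep c)) (leftℕ c) ≡ pair (leftℕ (rep d)) (leftℕ d) → c ≡ d
  nonrep-injective {c} {d} c≢rep d≢rep eq
    with pair-injective (rep-left≢ c≢rep) (rep-left≢ d≢rep) eq | right c ≟ᶠ right d
  ... | inj₁ (_ , ℓc≡ℓd) | yes rc≡rd = halves-determine (toℕ-injective ℓc≡ℓd) rc≡rd
  ... | inj₂ (_ , ℓc≡ℓrd) | yes rc≡rd =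
        ⊥-elim (rep-left≢ c≢rep (trans (cong leftℕ (rep-cong rc≡rd)) (sym ℓc≡ℓrd)))
  ... | inj₁ (ℓrc≡ℓrd , ℓc≡ℓd) | no rc≢rd = ⊥-elim (rectangle-free {rep c} {d} {c} {rep d}
        (λ e → rep-left≢ c≢rep (trans (cong toℕ e) (sym ℓc≡ℓd)))
        (λ e → rc≢rd (trans (sym (rep-fibre c)) e))
        (toℕ-injective ℓc≡ℓd) (sym (rep-fibre c)) (toℕ-injective (sym ℓrc≡ℓrd)) (rep-fibre d))
  ... | inj₂ (ℓrc≡ℓd , ℓc≡ℓrd) | no rc≢rd = ⊥-elim (rectangle-free {rep c} {rep d} {c} {d}
        (λ e → rep-left≢ c≢rep (trans (cong toℕ e) (sym ℓc≡ℓrd)))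
        (λ e → rc≢rd (trans (sym (rep-fibre c)) (trans e (rep-fibre d))))
        (toℕ-injective ℓc≡ℓrd) (sym (rep-fibre c)) (toℕ-injective (sym ℓrc≡ℓd)) (sym (rep-fibre d)))

  code : Fin M → ℕ
  code c with c ≟ᶠ rep c
  ... | yes _ = toℕ (right c)
  ... | no  _ = K + pair (leftℕ (rep c)) (leftℕ c)

  code-< : ∀ c → code c < K + triangle N
  code-< c with c ≟ᶠ rep c
  ... | yes _     = <-≤-trans (toℕ<n (right c)) (m≤m+n K (triangle N))
  ... | no c≢rep  = +-monoʳ-< K (pair-< (rep-left≢ c≢rep) (toℕ<n (left (rep c))) (toℕ<n (left c)))

  code-injective : ∀ {c d} → code c ≡ code d → c ≡ d
  code-injective {c} {d} eq with c ≟ᶠ rep c | d ≟ᶠ rep d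
  ... | yes c≡rep | yes d≡rep = trans c≡rep (trans (rep-cong (toℕ-injective eq)) (sym d≡rep))
  ... | yes _     | no _      = ⊥-elim (<⇒≢ (<-≤-trans (toℕ<n (right c)) (m≤m+n K _)) eq)
  ... | no _      | yes _     = ⊥-elim (<⇒≢ (<-≤-trans (toℕ<n (right d)) (m≤m+n K _)) (sym eq))
  ... | no c≢rep  | no d≢rep  = nonrep-injective c≢rep d≢rep (+-cancelˡ-≡ K _ _ eq)

  bound-for-split : M ≤ K + triangle N
  bound-for-split = injective-below⇒≤ code code-< code-injective

ssc-split-bound : ∀ {n M q} x m → x + m ≡ n → (C : Code n M q) → IsSSC 2 C →
                  M ≤ q ^ m + triangle (q ^ x)
ssc-split-bound x m refl C ssc = SplitCode.bound-for-split {x} {m} C ssc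

lemma10 : ∀ (n q : ℕ) → 1 ≤ n → 1 ≤ q →
    ∀ (M : ℕ) (C : Code n M q) → IsSSC 2 C → M ≤ bound n q
lemma10 n q _ _ M C ssc =
  subst (λ t → M ≤ q ^ ceil2n/3 n + t) (triangle-closed-form (q ^ floorn/3 n))
        (ssc-split-bound (floorn/3 n) (ceil2n/3 n) (floor+ceil≡n n) C ssc)
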